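{- For every positive integer $n$, the fan $F_{3n}$ has a vertex-minor isomorphic to a cycle of length $2n+1$.
   Context: Graphs are finite and simple. The fan $F_m$ is the graph on $m$ vertices with a specified vertex $c$ (the center) adjacent to all other vertices, such that $F_m\setminus c$ is a path on $m-1$ vertices. $G*v$ is local complementation at $v$ (flip adjacency of every pair of neighbors of $v$); $H$ is a vertex-minor of $G$ if it is an induced subgraph of a graph obtained from $G$ by a sequence of local complementations. -}

module Defs where

open import Data.Nat using (ℕ; zero; suc; _+_; _*_; _≡ᵇ_)
open import Data.Bool using (Bool; true; false; _∧_; _∨_; _xor_; not; if_then_else_)
open import Data.Fin using (Fin; toℕ)
open import Data.Fin.Properties using (_≟_)
open import Data.List using (List; foldl)
open import Data.Product using (Σ; _×_; ∃)
open import Relation.Nullary.Decidable using (⌊_⌋)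
open import Relation.Binary.PropositionalEquality using (_≡_)
open import Function.Definitions using (Injective)

-- Graphs on vertex set Fin n are given by Bool-valued adjacency functions.
-- (The specific graphs used below, fans and cycles, are simple: symmetric and
-- irreflexive; local complementation preserves this.)
Adj : ℕ → Set
Adj n = Fin n → Fin n → Bool

localComp : ∀ {n} → Adj n → Fin n → Adj n
localComp a v i j =
  if a v i ∧ a v j ∧ not ⌊ i ≟ j ⌋ then not (a i j) else a i j

localComps : ∀ {n} → Adj n → List (Fin n) → Adj n
localComps a vs = foldl localComp a vs

IsoToInduced : ∀ {k n} → Adj k → Adj n → Set
IsoToInduced {k} {n} h a =
  Σ (Fin k → Fin n) λ f → Injective _≡_ _≡_ f × (∀ i j → h i j ≡ a (f i) (f j))

VertexMinor : ∀ {k n} → Adj k → Adj n → Set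
VertexMinor h g = ∃ λ vs → IsoToInduced h (localComps g vs)

fanAdj : ∀ {m} → Adj m
fanAdj i j =
  let a = toℕ i ; b = toℕ j in
  not (a ≡ᵇ b) ∧ ((a ≡ᵇ 0) ∨ (b ≡ᵇ 0) ∨ (suc a ≡ᵇ b) ∨ (suc b ≡ᵇ a))

cycAdj : ∀ {k} → Adj k
cycAdj {k} i j =
  let a = toℕ i ; b = toℕ j in
  not (a ≡ᵇ b) ∧ ((suc a ≡ᵇ b) ∨ (suc b ≡ᵇ a) ∨ ((a ≡ᵇ 0) ∧ (suc b ≡ᵇ k)) ∨ ((b ≡ᵇ 0) ∧ (suc a ≡ᵇ k)))

-- Write the fan F_{3n+3} with centre 0 and path 1, 2, …, 3n+2. The pivots
-- 3, 6, …, 3n are pairwise non-adjacent, so local complementation at one of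
-- them does not change the neighbourhood {0, 3k+2, 3k+4} of the others, and
-- the whole sequence just toggles the triangles on these neighbourhoods: the
-- centre loses its edges to 3k+2 and 3k+4, and the edge 3k+2 — 3k+4 appears.
-- Deleting the pivots leaves the centre adjacent to 1 and 3n+2 only, and the
-- path 1, 2, 4, 5, 7, 8, …, 3n+1, 3n+2 between them: a cycle of length 2n+3.
module Submission where

open import Defs
open import Data.Bool using (Bool; true; false; _∧_; _∨_; _xor_; not; if_then_else_; T)
open import Data.Bool.Properties using (xor-assoc; xor-comm; xor-identityʳ; ∧-zeroʳ; ∧-identityʳ; ∨-identityʳ)
open import Data.Fin using (Fin; toℕ; fromℕ<)
open import Data.Fin.Properties using (_≟_; toℕ<n; toℕ-fromℕ<; toℕ-injective)
open import Data.List using (List; []; _∷_; foldl; foldr; map; applyUpTo; upTo)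
open import Data.List.Properties using (map-applyUpTo; map-upTo; map-cong; map-cong-local)
open import Data.List.Relation.Unary.All as All using (All; []; _∷_)
import Data.List.Relation.Unary.All.Properties as All
open import Data.List.Relation.Unary.AllPairs using (AllPairs; []; _∷_)
import Data.List.Relation.Unary.AllPairs.Properties as AllPairs
open import Data.Nat using (ℕ; zero; suc; _+_; _*_; _≡ᵇ_; _≤_; _<_; z≤n; s≤s)
open import Data.Nat.Properties using (≡ᵇ⇒≡; ≡⇒≡ᵇ)
import Data.Nat.Properties as ℕ
open import Data.Nat.Tactic.RingSolver using (solve-∀)
open import Data.Product using (_,_)
open import Data.Sum using (_⊎_; inj₁; inj₂)
open import Function.Bundles using (mk⇔)
open import Function.Definitions using (Injective)
open import Relation.Nullary.Decidable using (⌊_⌋; isYes≗does; does-⇔)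
open import Relation.Binary.PropositionalEquality
  using (_≡_; refl; sym; trans; cong; cong₂; subst; module ≡-Reasoning)
open ≡-Reasoning

Graphℕ : Set
Graphℕ = ℕ → ℕ → Bool

distinctPair : (ℕ → Bool) → ℕ → ℕ → Bool
distinctPair P a b = P a ∧ P b ∧ not (a ≡ᵇ b)

localCompℕ : Graphℕ → ℕ → Graphℕ
localCompℕ A v a b = if distinctPair (A v) a b then not (A a b) else A a b

does-≟-toℕ : ∀ {n} (i j : Fin n) → ⌊ i ≟ j ⌋ ≡ (toℕ i ≡ᵇ toℕ j)
does-≟-toℕ i j =
  trans (isYes≗does (i ≟ j)) (does-⇔ (mk⇔ (cong toℕ) toℕ-injective) (i ≟ j) (toℕ i ℕ.≟ toℕ j))

localComps-restrict : ∀ {n} (vs : List (Fin n)) {a : Adj n} {A : Graphℕ} →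
  (∀ i j → a i j ≡ A (toℕ i) (toℕ j)) →
  ∀ i j → localComps a vs i j ≡ foldl localCompℕ A (map toℕ vs) (toℕ i) (toℕ j)
localComps-restrict []       a≡A = a≡A
localComps-restrict (v ∷ vs) {a} {A} a≡A = localComps-restrict vs localComp≡
  where
  localComp≡ : ∀ i j → localComp a v i j ≡ localCompℕ A (toℕ v) (toℕ i) (toℕ j)
  localComp≡ i j rewrite a≡A v i | a≡A v j | a≡A i j | does-≟-toℕ i j = refl

localCompℕ-xor : ∀ A v a b → localCompℕ A v a b ≡ A a b xor distinctPair (A v) a b
localCompℕ-xor A v a b with distinctPair (A v) a b
... | true  = sym (xor-comm (A a b) true)
... | false = sym (xor-comm (A a b) false)

localCompℕ-nonNeighbour : ∀ A v w b → A v w ≡ false → localCompℕ A v w b ≡ A w b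
localCompℕ-nonNeighbour A v w b v≁w rewrite v≁w = refl

Independent : Graphℕ → List ℕ → Set
Independent A = AllPairs (λ v w → A v w ≡ false)

independent-localCompℕ : ∀ {A v ws} → All (λ w → A v w ≡ false) ws →
  Independent A ws → Independent (localCompℕ A v) ws
independent-localCompℕ []         []          = []
independent-localCompℕ {A} {v} (v≁w ∷ v≁ws) (w≁ws ∷ ind) =
  All.map (trans (localCompℕ-nonNeighbour A v _ _ v≁w)) w≁ws
    ∷ independent-localCompℕ v≁ws ind

xorSum : List Bool → Bool
xorSum = foldr _xor_ false

xorSum-false : ∀ {bs} → All (_≡ false) bs → xorSum bs ≡ false
xorSum-false []         = refl
xorSum-false (refl ∷ ps) = xorSum-false ps

localComps-independent : ∀ A ws → Independent A ws → ∀ a b →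
  foldl localCompℕ A ws a b ≡ A a b xor xorSum (map (λ w → distinctPair (A w) a b) ws)
localComps-independent A []       _            a b = sym (xor-identityʳ (A a b))
localComps-independent A (v ∷ ws) (v≁ws ∷ ind) a b = begin
    foldl localCompℕ (localCompℕ A v) ws a b
  ≡⟨ localComps-independent (localCompℕ A v) ws (independent-localCompℕ v≁ws ind) a b ⟩
    localCompℕ A v a b xor xorSum (map (λ w → distinctPair (localCompℕ A v w) a b) ws)
  ≡⟨ cong₂ _xor_ (localCompℕ-xor A v a b) (cong xorSum (map-cong-local (All.map unchanged v≁ws))) ⟩
    (A a b xor distinctPair (A v) a b) xor xorSum (map (λ w → distinctPair (A w) a b) ws)
  ≡⟨ xor-assoc (A a b) _ _ ⟩
    A a b xor xorSum (map (λ w → distinctPair (A w) a b) (v ∷ ws))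
  ∎
  where
  unchanged : ∀ {w} → A v w ≡ false → distinctPair (localCompℕ A v w) a b ≡ distinctPair (A w) a b
  unchanged {w} v≁w rewrite localCompℕ-nonNeighbour A v w a v≁w
                          | localCompℕ-nonNeighbour A v w b v≁w = refl

xorUpTo : ℕ → (ℕ → Bool) → Bool
xorUpTo n h = xorSum (applyUpTo h n)

syntax xorUpTo n (λ k → e) = ⨁[ k < n ] e

applyUpTo-cong : ∀ {A : Set} {f g : ℕ → A} → (∀ k → f k ≡ g k) → ∀ n → applyUpTo f n ≡ applyUpTo g n
applyUpTo-cong {f = f} {g} f≗g n =
  trans (sym (map-upTo f n)) (trans (map-cong f≗g (upTo n)) (map-upTo g n))

xorUpTo-head : ∀ h n → (∀ k → h (suc k) ≡ false) → xorUpTo (suc n) h ≡ h 0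
xorUpTo-head h n tail≡false =
  trans (cong (h 0 xor_) (xorSum-false (All.applyUpTo⁺₂ _ n tail≡false))) (xor-identityʳ (h 0))

-- fanAdj and cycAdj are, definitionally, the restrictions of fan and cycle to Fin.
fan : Graphℕ
fan a b = not (a ≡ᵇ b) ∧ ((a ≡ᵇ 0) ∨ (b ≡ᵇ 0) ∨ (suc a ≡ᵇ b) ∨ (suc b ≡ᵇ a))

cycle : ℕ → Graphℕ
cycle k a b =
  not (a ≡ᵇ b) ∧ ((suc a ≡ᵇ b) ∨ (suc b ≡ᵇ a) ∨ ((a ≡ᵇ 0) ∧ (suc b ≡ᵇ k)) ∨ ((b ≡ᵇ 0) ∧ (suc a ≡ᵇ k)))

pathAdj : Graphℕ
pathAdj a b = (suc a ≡ᵇ b) ∨ (suc b ≡ᵇ a)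

pathAdj-irreflexive : ∀ a b → not (a ≡ᵇ b) ∧ pathAdj a b ≡ pathAdj a b
pathAdj-irreflexive zero    zero    = refl
pathAdj-irreflexive zero    (suc b) = refl
pathAdj-irreflexive (suc a) zero    = refl
pathAdj-irreflexive (suc a) (suc b) = pathAdj-irreflexive a b

fan-suc-suc : ∀ a b → fan (suc a) (suc b) ≡ pathAdj a b
fan-suc-suc = pathAdj-irreflexive

cycle-suc-suc : ∀ k a b → cycle k (suc a) (suc b) ≡ pathAdj a b
cycle-suc-suc k a b =
  trans (cong (λ x → not (a ≡ᵇ b) ∧ ((suc a ≡ᵇ b) ∨ x)) (∨-identityʳ (suc b ≡ᵇ a)))
        (pathAdj-irreflexive a b)

cycle-zero-suc : ∀ m s → cycle (suc (suc m)) 0 (suc s) ≡ (s ≡ᵇ 0) ∨ (s ≡ᵇ m)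
cycle-zero-suc m zero    = refl
cycle-zero-suc m (suc s) = ∨-identityʳ (suc s ≡ᵇ m)

cycle-suc-zero : ∀ m t → cycle (suc (suc m)) (suc t) 0 ≡ (t ≡ᵇ 0) ∨ (t ≡ᵇ m)
cycle-suc-zero m zero    = refl
cycle-suc-zero m (suc t) = refl

-- The fan vertex suc p is the p-th vertex of its path; embedPath enumerates
-- the path indices 0, 1, 3, 4, 6, 7, … of the non-pivots. The recursive
-- definitions make a shift by one pivot (three fan vertices, two cycle
-- vertices) a definitional step.
triple : ℕ → ℕ
triple zero    = zero
triple (suc k) = 3 + triple k

pivotIndex : ℕ → ℕ
pivotIndex k = 2 + triple k

pivot : ℕ → ℕ
pivot k = suc (pivotIndex k)

pivots : ℕ → List ℕ
pivots = applyUpTo pivot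

embedPath : ℕ → ℕ
embedPath zero          = 0
embedPath (suc zero)    = 1
embedPath (suc (suc a)) = 3 + embedPath a

embed : ℕ → ℕ
embed zero    = 0
embed (suc a) = suc (embedPath a)

double : ℕ → ℕ
double zero    = zero
double (suc k) = suc (suc (double k))

odd : ℕ → ℕ
odd k = suc (double k)

-- star k = {0, 2k+2, 2k+3} is the neighbourhood of the k-th pivot in cycle
-- coordinates.
bridge : ℕ → ℕ → Bool
bridge k a = (a ≡ᵇ odd k) ∨ (a ≡ᵇ suc (odd k))

star : ℕ → ℕ → Bool
star k zero    = true
star k (suc a) = bridge k a

pathAdj-pivotIndex : ∀ {k m} → k < m → pathAdj (pivotIndex k) (pivotIndex m) ≡ false
pathAdj-pivotIndex {zero}  {suc m} _         = refl
pathAdj-pivotIndex {suc k} {suc m} (s≤s k<m) = pathAdj-pivotIndex k<m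

pivots-independent : ∀ n → Independent fan (pivots n)
pivots-independent n =
  AllPairs.applyUpTo⁺₁ pivot n λ {i} {j} i<j _ →
    trans (fan-suc-suc (pivotIndex i) (pivotIndex j)) (pathAdj-pivotIndex i<j)

pathAdj-pivotIndex-embedPath : ∀ k a → pathAdj (pivotIndex k) (embedPath a) ≡ bridge k a
pathAdj-pivotIndex-embedPath zero    zero                      = refl
pathAdj-pivotIndex-embedPath zero    (suc zero)                = refl
pathAdj-pivotIndex-embedPath zero    (suc (suc zero))          = refl
pathAdj-pivotIndex-embedPath zero    (suc (suc (suc zero)))    = refl
pathAdj-pivotIndex-embedPath zero    (suc (suc (suc (suc a)))) = refl
pathAdj-pivotIndex-embedPath (suc k) zero                      = refl
pathAdj-pivotIndex-embedPath (suc k) (suc zero)                = refl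
pathAdj-pivotIndex-embedPath (suc k) (suc (suc a))             = pathAdj-pivotIndex-embedPath k a

fan-pivot-embed : ∀ k t → fan (pivot k) (embed t) ≡ star k t
fan-pivot-embed k zero    = refl
fan-pivot-embed k (suc a) =
  trans (fan-suc-suc (pivotIndex k) (embedPath a)) (pathAdj-pivotIndex-embedPath k a)

embedPath-≡ᵇ : ∀ a b → (embedPath a ≡ᵇ embedPath b) ≡ (a ≡ᵇ b)
embedPath-≡ᵇ zero          zero          = refl
embedPath-≡ᵇ zero          (suc zero)    = refl
embedPath-≡ᵇ zero          (suc (suc b)) = refl
embedPath-≡ᵇ (suc zero)    zero          = refl
embedPath-≡ᵇ (suc zero)    (suc zero)    = refl
embedPath-≡ᵇ (suc zero)    (suc (suc b)) = refl
embedPath-≡ᵇ (suc (suc a)) zero          = refl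
embedPath-≡ᵇ (suc (suc a)) (suc zero)    = refl
embedPath-≡ᵇ (suc (suc a)) (suc (suc b)) = embedPath-≡ᵇ a b

embed-≡ᵇ : ∀ a b → (embed a ≡ᵇ embed b) ≡ (a ≡ᵇ b)
embed-≡ᵇ zero    zero    = refl
embed-≡ᵇ zero    (suc b) = refl
embed-≡ᵇ (suc a) zero    = refl
embed-≡ᵇ (suc a) (suc b) = embedPath-≡ᵇ a b

embed-injective : Injective _≡_ _≡_ embed
embed-injective {a} {b} eq = ≡ᵇ⇒≡ a b (subst T (embed-≡ᵇ a b) (≡⇒≡ᵇ _ _ eq))

distinctPair-pivot-embed : ∀ k t s →
  distinctPair (fan (pivot k)) (embed t) (embed s) ≡ distinctPair (star k) t s
distinctPair-pivot-embed k t s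
  rewrite fan-pivot-embed k t | fan-pivot-embed k s | embed-≡ᵇ t s = refl

-- The fan path, restricted to non-pivots, is the matching 2q — 2q+1;
-- bridge k adds the edge 2k+1 — 2k+2.
bridge₀ : ∀ a b → a ≤ 1 ⊎ b ≤ 1 →
  pathAdj (embedPath a) (embedPath b) xor distinctPair (bridge 0) a b ≡ pathAdj a b
bridge₀ zero                zero                _ = refl
bridge₀ zero                (suc zero)          _ = refl
bridge₀ zero                (suc (suc zero))    _ = refl
bridge₀ zero                (suc (suc (suc b))) _ = refl
bridge₀ (suc zero)          zero                _ = refl
bridge₀ (suc zero)          (suc zero)          _ = refl
bridge₀ (suc zero)          (suc (suc zero))    _ = refl
bridge₀ (suc zero)          (suc (suc (suc b))) _ = refl
bridge₀ (suc (suc zero))    zero                _ = refl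
bridge₀ (suc (suc zero))    (suc zero)          _ = refl
bridge₀ (suc (suc (suc a))) zero                _ = refl
bridge₀ (suc (suc (suc a))) (suc zero)          _ = refl
bridge₀ (suc (suc a))       (suc (suc b))       (inj₁ (s≤s ()))
bridge₀ (suc (suc a))       (suc (suc b))       (inj₂ (s≤s ()))

later-bridges-miss : ∀ a b → a ≤ 1 ⊎ b ≤ 1 → ∀ k → distinctPair (bridge (suc k)) a b ≡ false
later-bridges-miss zero          b             _ k = refl
later-bridges-miss (suc zero)    b             _ k = refl
later-bridges-miss a             zero          _ k = ∧-zeroʳ (bridge (suc k) a)
later-bridges-miss a             (suc zero)    _ k = ∧-zeroʳ (bridge (suc k) a)
later-bridges-miss (suc (suc a)) (suc (suc b)) (inj₁ (s≤s ())) k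
later-bridges-miss (suc (suc a)) (suc (suc b)) (inj₂ (s≤s ())) k

distinctPair-bridge₀-shift : ∀ a b → distinctPair (bridge 0) (suc (suc a)) (suc (suc b)) ≡ false
distinctPair-bridge₀-shift zero    zero    = refl
distinctPair-bridge₀-shift zero    (suc b) = refl
distinctPair-bridge₀-shift (suc a) b       = refl

path-xor-bridges-nearStart : ∀ n a b → a ≤ 1 ⊎ b ≤ 1 →
  pathAdj (embedPath a) (embedPath b) xor (⨁[ k < suc n ] distinctPair (bridge k) a b) ≡ pathAdj a b
path-xor-bridges-nearStart n a b near =
  trans (cong (pathAdj (embedPath a) (embedPath b) xor_)
              (xorUpTo-head (λ k → distinctPair (bridge k) a b) n (later-bridges-miss a b near)))
        (bridge₀ a b near)

path-xor-bridges : ∀ n a b → a ≤ odd n → b ≤ odd n →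
  pathAdj (embedPath a) (embedPath b) xor (⨁[ k < n ] distinctPair (bridge k) a b) ≡ pathAdj a b
path-xor-bridges zero    zero            zero          _ _ = refl
path-xor-bridges zero    zero            (suc zero)    _ _ = refl
path-xor-bridges zero    (suc zero)      zero          _ _ = refl
path-xor-bridges zero    (suc zero)      (suc zero)    _ _ = refl
path-xor-bridges zero    (suc (suc a))   b             (s≤s ()) _
path-xor-bridges zero    a               (suc (suc b)) _ (s≤s ())
path-xor-bridges (suc n) zero            b             _ _ = path-xor-bridges-nearStart n _ b (inj₁ z≤n)
path-xor-bridges (suc n) (suc zero)      b             _ _ = path-xor-bridges-nearStart n _ b (inj₁ (s≤s z≤n))
path-xor-bridges (suc n) a@(suc (suc _)) zero          _ _ = path-xor-bridges-nearStart n a _ (inj₂ z≤n)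
path-xor-bridges (suc n) a@(suc (suc _)) (suc zero)    _ _ = path-xor-bridges-nearStart n a _ (inj₂ (s≤s z≤n))
path-xor-bridges (suc n) (suc (suc a))   (suc (suc b)) (s≤s (s≤s a≤)) (s≤s (s≤s b≤))
  rewrite distinctPair-bridge₀-shift a b = path-xor-bridges n a b a≤ b≤

center-xor-bridges : ∀ n s → s ≤ odd n →
  true xor (⨁[ k < n ] bridge k s) ≡ (s ≡ᵇ 0) ∨ (s ≡ᵇ odd n)
center-xor-bridges zero    zero                _ = refl
center-xor-bridges zero    (suc zero)          _ = refl
center-xor-bridges zero    (suc (suc s))       (s≤s ())
center-xor-bridges (suc n) zero                _
  rewrite xorSum-false (All.applyUpTo⁺₂ (λ k → bridge k 0) (suc n) (λ _ → refl)) = refl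
center-xor-bridges (suc n) (suc zero)          _
  rewrite xorUpTo-head (λ k → bridge k 1) n (λ _ → refl) = refl
center-xor-bridges (suc n) (suc (suc zero))    _
  rewrite xorUpTo-head (λ k → bridge k 2) n (λ _ → refl) = refl
center-xor-bridges (suc n) (suc (suc (suc s))) (s≤s (s≤s s≤)) = center-xor-bridges n (suc s) s≤

fan-xor-stars : ∀ n t s → t ≤ suc (odd n) → s ≤ suc (odd n) →
  fan (embed t) (embed s) xor (⨁[ k < n ] distinctPair (star k) t s) ≡ cycle (suc (suc (odd n))) t s
fan-xor-stars n zero zero _ _
  rewrite xorSum-false (All.applyUpTo⁺₂ (λ k → distinctPair (star k) 0 0) n (λ _ → refl)) = refl
fan-xor-stars n zero (suc s) _ (s≤s s≤) = begin
    true xor (⨁[ k < n ] (bridge k s ∧ true))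
  ≡⟨ cong (λ bs → true xor xorSum bs) (applyUpTo-cong (λ k → ∧-identityʳ (bridge k s)) n) ⟩
    true xor (⨁[ k < n ] bridge k s)
  ≡⟨ center-xor-bridges n s s≤ ⟩
    (s ≡ᵇ 0) ∨ (s ≡ᵇ odd n)
  ≡⟨ cycle-zero-suc (odd n) s ⟨
    cycle (suc (suc (odd n))) 0 (suc s)
  ∎
fan-xor-stars n (suc t) zero (s≤s t≤) _ = begin
    true xor (⨁[ k < n ] (bridge k t ∧ true))
  ≡⟨ cong (λ bs → true xor xorSum bs) (applyUpTo-cong (λ k → ∧-identityʳ (bridge k t)) n) ⟩
    true xor (⨁[ k < n ] bridge k t)
  ≡⟨ center-xor-bridges n t t≤ ⟩
    (t ≡ᵇ 0) ∨ (t ≡ᵇ odd n)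
  ≡⟨ cycle-suc-zero (odd n) t ⟨
    cycle (suc (suc (odd n))) (suc t) 0
  ∎
fan-xor-stars n (suc t) (suc s) (s≤s t≤) (s≤s s≤) = begin
    fan (suc (embedPath t)) (suc (embedPath s)) xor (⨁[ k < n ] distinctPair (bridge k) t s)
  ≡⟨ cong (_xor (⨁[ k < n ] distinctPair (bridge k) t s)) (fan-suc-suc (embedPath t) (embedPath s)) ⟩
    pathAdj (embedPath t) (embedPath s) xor (⨁[ k < n ] distinctPair (bridge k) t s)
  ≡⟨ path-xor-bridges n t s t≤ s≤ ⟩
    pathAdj t s
  ≡⟨ cycle-suc-suc (suc (suc (odd n))) t s ⟨
    cycle (suc (suc (odd n))) (suc t) (suc s)
  ∎

localComps-fan-pivots : ∀ n t s → t ≤ suc (odd n) → s ≤ suc (odd n) →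
  foldl localCompℕ fan (pivots n) (embed t) (embed s) ≡ cycle (suc (suc (odd n))) t s
localComps-fan-pivots n t s t≤ s≤ = begin
    foldl localCompℕ fan (pivots n) (embed t) (embed s)
  ≡⟨ localComps-independent fan (pivots n) (pivots-independent n) (embed t) (embed s) ⟩
    fan (embed t) (embed s) xor xorSum (map (λ w → distinctPair (fan w) (embed t) (embed s)) (pivots n))
  ≡⟨ cong (λ bs → fan (embed t) (embed s) xor xorSum bs)
          (trans (map-applyUpTo pivot _ n) (applyUpTo-cong (λ k → distinctPair-pivot-embed k t s) n)) ⟩
    fan (embed t) (embed s) xor (⨁[ k < n ] distinctPair (star k) t s)
  ≡⟨ fan-xor-stars n t s t≤ s≤ ⟩
    cycle (suc (suc (odd n))) t s
  ∎

cycleSize : ∀ n → 2 * suc n + 1 ≡ suc (suc (odd n))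
cycleSize zero    = refl
cycleSize (suc n) = trans (shift n) (cong (λ m → suc (suc m)) (cycleSize n))
  where
  shift : ∀ n → 2 * suc (suc n) + 1 ≡ suc (suc (2 * suc n + 1))
  shift = solve-∀

fanSize : ∀ n → 3 * suc n ≡ pivot n
fanSize zero    = refl
fanSize (suc n) = trans (shift n) (cong (3 +_) (fanSize n))
  where
  shift : ∀ n → 3 * suc (suc n) ≡ 3 + 3 * suc n
  shift = solve-∀

pivot-< : ∀ {k m} → k < m → pivot k < pivot m
pivot-< {zero}  {suc m} _         = s≤s (s≤s (s≤s (s≤s z≤n)))
pivot-< {suc k} {suc m} (s≤s k<m) = s≤s (s≤s (s≤s (pivot-< k<m)))

embedPath-< : ∀ n a → a ≤ odd n → embedPath a < pivotIndex n
embedPath-< zero    zero          _                = s≤s z≤n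
embedPath-< zero    (suc zero)    _                = s≤s (s≤s z≤n)
embedPath-< zero    (suc (suc a)) (s≤s ())
embedPath-< (suc n) zero          _                = s≤s z≤n
embedPath-< (suc n) (suc zero)    _                = s≤s (s≤s z≤n)
embedPath-< (suc n) (suc (suc a)) (s≤s (s≤s a≤)) = s≤s (s≤s (s≤s (embedPath-< n a a≤)))

embed-< : ∀ n t → t ≤ suc (odd n) → embed t < pivot n
embed-< n zero    _        = s≤s z≤n
embed-< n (suc a) (s≤s a≤) = s≤s (embedPath-< n a a≤)

toℕ-cycle-≤ : ∀ n (i : Fin (2 * suc n + 1)) → toℕ i ≤ suc (odd n)
toℕ-cycle-≤ n i with s≤s i≤ ← subst (toℕ i <_) (cycleSize n) (toℕ<n i) = i≤

embedFin : ∀ n → Fin (2 * suc n + 1) → Fin (3 * suc n)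
embedFin n i = fromℕ< (subst (embed (toℕ i) <_) (sym (fanSize n)) (embed-< n (toℕ i) (toℕ-cycle-≤ n i)))

toℕ-embedFin : ∀ n i → toℕ (embedFin n i) ≡ embed (toℕ i)
toℕ-embedFin n i = toℕ-fromℕ< _

embedFin-injective : ∀ n → Injective _≡_ _≡_ (embedFin n)
embedFin-injective n {i} {j} eq = toℕ-injective (embed-injective (begin
  embed (toℕ i)      ≡⟨ toℕ-embedFin n i ⟨
  toℕ (embedFin n i) ≡⟨ cong toℕ eq ⟩
  toℕ (embedFin n j) ≡⟨ toℕ-embedFin n j ⟩
  embed (toℕ j)      ∎))

pivots-< : ∀ n → All (_< 3 * suc n) (pivots n)
pivots-< n =
  All.applyUpTo⁺₁ pivot n (λ {k} k<n → subst (pivot k <_) (sym (fanSize n)) (pivot-< k<n))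

pivotsFin : ∀ n → List (Fin (3 * suc n))
pivotsFin n = All.reduce (λ x<N → fromℕ< x<N) (pivots-< n)

map-toℕ-reduce-fromℕ< : ∀ {N xs} (xs<N : All (_< N) xs) →
  map toℕ (All.reduce (λ x<N → fromℕ< x<N) xs<N) ≡ xs
map-toℕ-reduce-fromℕ< []            = refl
map-toℕ-reduce-fromℕ< (x<N ∷ xs<N) = cong₂ _∷_ (toℕ-fromℕ< x<N) (map-toℕ-reduce-fromℕ< xs<N)

lemma4p2 : (n : ℕ) → VertexMinor (cycAdj {2 * suc n + 1}) (fanAdj {3 * suc n})
lemma4p2 n = pivotsFin n , embedFin n , embedFin-injective n , λ i j → sym (begin
    localComps fanAdj (pivotsFin n) (embedFin n i) (embedFin n j)
  ≡⟨ localComps-restrict (pivotsFin n) (λ _ _ → refl) (embedFin n i) (embedFin n j) ⟩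
    foldl localCompℕ fan (map toℕ (pivotsFin n)) (toℕ (embedFin n i)) (toℕ (embedFin n j))
  ≡⟨ cong₂ (foldl localCompℕ fan (map toℕ (pivotsFin n))) (toℕ-embedFin n i) (toℕ-embedFin n j) ⟩
    foldl localCompℕ fan (map toℕ (pivotsFin n)) (embed (toℕ i)) (embed (toℕ j))
  ≡⟨ cong (λ ws → foldl localCompℕ fan ws (embed (toℕ i)) (embed (toℕ j))) (map-toℕ-reduce-fromℕ< (pivots-< n)) ⟩
    foldl localCompℕ fan (pivots n) (embed (toℕ i)) (embed (toℕ j))
  ≡⟨ localComps-fan-pivots n (toℕ i) (toℕ j) (toℕ-cycle-≤ n i) (toℕ-cycle-≤ n j) ⟩
    cycle (suc (suc (odd n))) (toℕ i) (toℕ j)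
  ≡⟨ cong (λ K → cycle K (toℕ i) (toℕ j)) (cycleSize n) ⟨
    cycAdj i j
  ∎)
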